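{- Let $P_{\mathcal U}$ be a proposition in a universe $\mathcal U$ and $\mathcal V$ a universe. Consider the poset $\mathcal L_{\mathcal V}(P_{\mathcal U}):=\Sigma_{Q:\Omega_{\mathcal V}}(Q\to P_{\mathcal U})$ ordered by implication of first components. If $\mathcal L_{\mathcal V}(P_{\mathcal U})$ has a maximal element with first component $Q:\Omega_{\mathcal V}$, then $P_{\mathcal U}$ is equivalent to $Q$ and this element is the greatest element of $\mathcal L_{\mathcal V}(P_{\mathcal U})$; in particular $P_{\mathcal U}$ is $\mathcal V$-small. Conversely, if $P_{\mathcal U}$ is equivalent to a proposition $Q:\Omega_{\mathcal V}$, then $Q$ (with the map $Q\to P_{\mathcal U}$) is the greatest element of $\mathcal L_{\mathcal V}(P_{\mathcal U})$.
   Context: Setting: intensional Martin-Löf type theory with type universes, function extensionality, propositional extensionality and propositional truncations; no resizing. $\Omega_{\mathcal V}$ is the type of propositions (types with at most one element up to equality) in $\mathcal V$. A type is $\mathcal V$-small if equivalent to a type in $\mathcal V$. An element $m$ is maximal if $m\sqsubseteq m'$ implies $m=m'$. -}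

module Defs where

open import Level using (Level; _⊔_; Setω) renaming (suc to lsuc)
open import Data.Product using (Σ; _,_; proj₁; proj₂)
open import Relation.Binary.PropositionalEquality using (_≡_)
open import Function.Bundles using (_↔_)

isProp : ∀ {a} → Set a → Set a
isProp A = (x y : A) → x ≡ y

Ω : (𝓥 : Level) → Set (lsuc 𝓥)
Ω 𝓥 = Σ (Set 𝓥) isProp

FunExt : Setω
FunExt = ∀ {a b} {A : Set a} {B : A → Set b} {f g : (x : A) → B x} →
         ((x : A) → f x ≡ g x) → f ≡ g

PropExt : (𝓥 : Level) → Set (lsuc 𝓥)
PropExt 𝓥 = {P Q : Set 𝓥} → isProp P → isProp Q → (P → Q) → (Q → P) → P ≡ Q

isSmall : ∀ {𝓤} (𝓥 : Level) → Set 𝓤 → Set (𝓤 ⊔ lsuc 𝓥)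
isSmall 𝓥 X = Σ (Set 𝓥) (λ Y → X ↔ Y)

𝓛 : ∀ {𝓤} (𝓥 : Level) → Set 𝓤 → Set (𝓤 ⊔ lsuc 𝓥)
𝓛 𝓥 P = Σ (Ω 𝓥) (λ Q → proj₁ Q → P)

_⊑_ : ∀ {𝓤 𝓥} {P : Set 𝓤} → 𝓛 𝓥 P → 𝓛 𝓥 P → Set 𝓥
m ⊑ m' = proj₁ (proj₁ m) → proj₁ (proj₁ m')

isMaximal : ∀ {𝓤 𝓥} {P : Set 𝓤} → 𝓛 𝓥 P → Set (𝓤 ⊔ lsuc 𝓥)
isMaximal {P = P} m = (m' : 𝓛 _ P) → m ⊑ m' → m ≡ m'

isGreatest : ∀ {𝓤 𝓥} {P : Set 𝓤} → 𝓛 𝓥 P → Set (𝓤 ⊔ lsuc 𝓥)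
isGreatest {P = P} m = (m' : 𝓛 _ P) → m' ⊑ m

-- A maximal m lies below the element ⊤ → P picked out by any p : P, so maximality
-- forces ⊤ = Q and hence P → Q; together with Q → P this makes P and Q equivalent,
-- and then every element of 𝓛 𝓥 P, being a subproposition of P, lies below m.
module Submission where

open import Defs
open import Level using (Level; Lift; lift)
open import Data.Product using (_×_; _,_; proj₁)
open import Data.Unit using (⊤; tt)
open import Function.Bundles using (_↔_; Inverse; mk↔ₛ′)
open import Relation.Binary.PropositionalEquality using (refl)

module _ {𝓤 𝓥 : Level} {P : Set 𝓤} where

  carrier : 𝓛 𝓥 P → Set 𝓥
  carrier m = proj₁ (proj₁ m)

  ⊤-point : P → 𝓛 𝓥 P
  ⊤-point p = (Lift 𝓥 ⊤ , λ _ _ → refl) , λ _ → p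

  maximal⇒upper : (m : 𝓛 𝓥 P) → isMaximal m → P → carrier m
  maximal⇒upper m max p with max (⊤-point p) (λ _ → lift tt)
  ... | refl = lift tt

  maximal⇒↔ : isProp P → (m : 𝓛 𝓥 P) → isMaximal m → P ↔ carrier m
  maximal⇒↔ propP m@((_ , propQ) , from) max =
    mk↔ₛ′ (maximal⇒upper m max) from (λ _ → propQ _ _) (λ _ → propP _ _)

  ↔⇒isGreatest : (Q : Ω 𝓥) (e : P ↔ proj₁ Q) → isGreatest (Q , Inverse.from e)
  ↔⇒isGreatest Q e (_ , g) q = Inverse.to e (g q)

  maximal⇒isGreatest : (m : 𝓛 𝓥 P) → isMaximal m → isGreatest m
  maximal⇒isGreatest m max (_ , g) q = maximal⇒upper m max (g q)

mainTheorem10 : FunExt → (∀ {𝓥} → PropExt 𝓥) →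
    {𝓤 𝓥 : Level} (P : Set 𝓤) → isProp P →
    ((m : 𝓛 𝓥 P) → isMaximal m →
    (P ↔ proj₁ (proj₁ m)) × isGreatest m × isSmall 𝓥 P)
    × ((Q : Ω 𝓥) (e : P ↔ proj₁ Q) → isGreatest {P = P} (Q , Inverse.from e))
mainTheorem10 _ _ P propP = maximal⇒greatest-and-small , ↔⇒isGreatest
  where
  maximal⇒greatest-and-small : (m : 𝓛 _ P) → isMaximal m →
    (P ↔ carrier m) × isGreatest m × isSmall _ P
  maximal⇒greatest-and-small m max =
    maximal⇒↔ propP m max , maximal⇒isGreatest m max , (carrier m , maximal⇒↔ propP m max)
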